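{- For every integer $n>9$, the inequality $\theta(n)<\left(2^{2^{n-5}}-1\right)^{2^{n-5}}+1$ implies that $2^{2^{n-5}}+1$ is composite.
   Context: For a positive integer $n$, let $E_n=\{x_i \cdot x_j=x_k,\ x_i+1=x_k:\ i,j,k \in \{1,\ldots,n\}\}$, a set of equations in the variables $x_1,\ldots,x_n$. Let $\theta(n)$ denote the smallest positive integer $b$ such that for each system $S \subseteq E_n$ which has a solution in positive integers $x_1,\ldots,x_n$ and which has only finitely many solutions in positive integers $x_1,\ldots,x_n$, there exists a solution of $S$ in $([1,b] \cap \mathbb{N})^n$. -}

module Defs where

open import Data.Nat using (ℕ; _+_; _*_; _≤_; _<_)
open import Data.Fin using (Fin)
open import Data.List using (List)
open import Data.List.Membership.Propositional using (_∈_)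
open import Data.List.Relation.Unary.Any using (Any)
open import Data.Product using (Σ; _×_)
open import Relation.Binary.PropositionalEquality using (_≡_)

data Eqn (n : ℕ) : Set where
  mulE  : Fin n → Fin n → Fin n → Eqn n
  succE : Fin n → Fin n → Eqn n

Sat : {n : ℕ} → (Fin n → ℕ) → Eqn n → Set
Sat x (mulE i j k) = x i * x j ≡ x k
Sat x (succE i k)  = x i + 1 ≡ x k

System : ℕ → Set
System n = List (Eqn n)

Solution : {n : ℕ} → System n → (Fin n → ℕ) → Set
Solution {n} S x = (∀ (i : Fin n) → 1 ≤ x i) × (∀ e → e ∈ S → Sat x e)

Solvable : {n : ℕ} → System n → Set
Solvable {n} S = Σ (Fin n → ℕ) (λ x → Solution S x)

FinitelyManySolutions : {n : ℕ} → System n → Set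
FinitelyManySolutions {n} S =
  Σ (List (Fin n → ℕ)) (λ L →
    ∀ x → Solution S x → Any (λ y → ∀ (i : Fin n) → y i ≡ x i) L)

-- The property defining θ(n): every solvable system with finitely many
-- solutions has a solution in ([1,b] ∩ ℕ)^n.
GoodBound : ℕ → ℕ → Set
GoodBound n b =
  ∀ (S : System n) → Solvable S → FinitelyManySolutions S →
    Σ (Fin n → ℕ) (λ x → Solution S x × (∀ (i : Fin n) → x i ≤ b))

IsTheta : ℕ → ℕ → Set
IsTheta n b = 1 ≤ b × GoodBound n b × (∀ b′ → 1 ≤ b′ → GoodBound n b′ → b ≤ b′)

{-# OPTIONS --safe #-}
module Submission where

-- Consider the system with unknowns x, x + 1, d = x + 2, q, t = x ^ 2 ^ K + 1 and the
-- squaring chain x, x², x⁴, …, x ^ 2 ^ K (K = n - 5, so n unknowns in all), and the equation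
-- d * q = t says exactly that x + 2 divides x ^ 2 ^ K + 1.  As x ≡ -2 modulo x + 2 and 2 ^ K
-- is even, this is equivalent to x + 2 dividing the Fermat number F = 2 ^ 2 ^ K + 1.  Hence
-- every solution is determined by x < F (finitely many solutions), x = F - 2 is a solution,
-- and a solution with t ≤ θ(n) < (F - 2) ^ 2 ^ K + 1 has x < F - 2, so x + 2 is a proper
-- divisor of F.

open import Defs
open import Data.Nat
  using (ℕ; zero; suc; _+_; _∸_; _*_; _^_; _%_; _/_; _≤_; _<_; _<?_; s≤s; z<s; NonZero; >-nonZero; ≢-nonZero)
open import Data.Nat.Properties
open import Data.Nat.DivMod using (%-distribˡ-*; %-distribˡ-+; [m+kn]%n≡m%n; m*[n/m]≡n; m*n/n≡m)
open import Data.Nat.Divisibility using (_∣_; divides; ∣-refl; ∣⇒≤; m%n≡0⇒n∣m; n∣m⇒m%n≡0)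
open import Data.Nat.Primality using (Composite; composite)
open import Data.Nat.Solver using (module +-*-Solver)
open import Data.Fin using (Fin; toℕ; fromℕ; inject₁)
open import Data.Fin.Properties using (toℕ-fromℕ; toℕ-inject₁)
open import Data.Fin.Induction using (<-weakInduction)
open import Data.List using (_∷_; map; allFin; upTo)
open import Data.List.Relation.Unary.Any using (here; there)
import Data.List.Relation.Unary.Any as Any
open import Data.List.Relation.Unary.Any.Properties using (map⁺)
open import Data.List.Membership.Propositional using (_∈_)
open import Data.List.Membership.Propositional.Properties using (∈-map⁺; ∈-map⁻; ∈-allFin; ∈-upTo⁺)
open import Data.Product using (_,_; proj₂)
open import Function.Bundles using (_⇔_; mk⇔; Equivalence)
open import Relation.Nullary using (yes; no; contradiction)
open import Relation.Binary.PropositionalEquality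

m+1≢0 : ∀ m → m + 1 ≢ 0
m+1≢0 m eq = 1+n≢0 (trans (+-comm 1 m) eq)

2+[m∸1]≡m+1 : ∀ {m} → 1 ≤ m → 2 + (m ∸ 1) ≡ m + 1
2+[m∸1]≡m+1 {m} 1≤m = trans (cong suc (+-comm 1 (m ∸ 1))) (trans (cong suc (m∸n+n≡m 1≤m)) (+-comm 1 m))

^-2^-suc : ∀ x j → x ^ 2 ^ suc j ≡ x ^ 2 ^ j * x ^ 2 ^ j
^-2^-suc x j = begin
  x ^ (2 ^ j + (2 ^ j + 0)) ≡⟨ cong (λ e → x ^ (2 ^ j + e)) (+-identityʳ (2 ^ j)) ⟩
  x ^ (2 ^ j + 2 ^ j)       ≡⟨ ^-distribˡ-+-* x (2 ^ j) (2 ^ j) ⟩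
  x ^ 2 ^ j * x ^ 2 ^ j     ∎
  where open ≡-Reasoning

^-cancelˡ-< : ∀ m {a b} → a ^ m < b ^ m → a < b
^-cancelˡ-< m {a} {b} aᵐ<bᵐ with a <? b
... | yes a<b = a<b
... | no a≮b = contradiction aᵐ<bᵐ (≤⇒≯ (^-monoˡ-≤ m (≮⇒≥ a≮b)))

2≤2^2^n : ∀ n → 2 ≤ 2 ^ 2 ^ n
2≤2^2^n n = ^-monoʳ-≤ 2 (m^n>0 2 n)

module _ {d : ℕ} .{{_ : NonZero d}} where

  %-cong-+ : ∀ {a a′ b b′} → a % d ≡ a′ % d → b % d ≡ b′ % d → (a + b) % d ≡ (a′ + b′) % d
  %-cong-+ {a} {a′} {b} {b′} a≡a′ b≡b′ = begin
    (a + b) % d                   ≡⟨ %-distribˡ-+ a b d ⟩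
    ((a % d) + (b % d)) % d       ≡⟨ cong₂ (λ u v → (u + v) % d) a≡a′ b≡b′ ⟩
    ((a′ % d) + (b′ % d)) % d     ≡⟨ %-distribˡ-+ a′ b′ d ⟨
    (a′ + b′) % d                 ∎
    where open ≡-Reasoning

  %-cong-* : ∀ {a a′ b b′} → a % d ≡ a′ % d → b % d ≡ b′ % d → (a * b) % d ≡ (a′ * b′) % d
  %-cong-* {a} {a′} {b} {b′} a≡a′ b≡b′ = begin
    (a * b) % d                   ≡⟨ %-distribˡ-* a b d ⟩
    ((a % d) * (b % d)) % d       ≡⟨ cong₂ (λ u v → (u * v) % d) a≡a′ b≡b′ ⟩
    ((a′ % d) * (b′ % d)) % d     ≡⟨ %-distribˡ-* a′ b′ d ⟨
    (a′ * b′) % d                 ∎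
    where open ≡-Reasoning

  %-cong-^ : ∀ {a b} m → a % d ≡ b % d → (a ^ m) % d ≡ (b ^ m) % d
  %-cong-^ zero    a≡b = refl
  %-cong-^ (suc m) a≡b = %-cong-* a≡b (%-cong-^ m a≡b)

  ∣-resp-% : ∀ {a b} → a % d ≡ b % d → d ∣ a → d ∣ b
  ∣-resp-% {a} {b} a≡b d∣a = m%n≡0⇒n∣m b d (trans (sym a≡b) (n∣m⇒m%n≡0 a d d∣a))

x^2%[2+x]≡2^2%[2+x] : ∀ x → (x ^ 2) % (2 + x) ≡ (2 ^ 2) % (2 + x)
x^2%[2+x]≡2^2%[2+x] x = begin
  (x ^ 2) % (2 + x)                   ≡⟨ [m+kn]%n≡m%n (x ^ 2) 2 (2 + x) ⟨
  (x ^ 2 + 2 * (2 + x)) % (2 + x)     ≡⟨ cong (_% (2 + x)) identity ⟩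
  (2 ^ 2 + x * (2 + x)) % (2 + x)     ≡⟨ [m+kn]%n≡m%n (2 ^ 2) x (2 + x) ⟩
  (2 ^ 2) % (2 + x)                   ∎
  where
  open ≡-Reasoning
  open +-*-Solver
  identity : x ^ 2 + 2 * (2 + x) ≡ 2 ^ 2 + x * (2 + x)
  identity = solve 1 (λ y → y :^ 2 :+ con 2 :* (con 2 :+ y) := con 2 :^ 2 :+ y :* (con 2 :+ y)) refl x

x^[2m]%[2+x]≡2^[2m]%[2+x] : ∀ x m → (x ^ (2 * m)) % (2 + x) ≡ (2 ^ (2 * m)) % (2 + x)
x^[2m]%[2+x]≡2^[2m]%[2+x] x m = begin
  (x ^ (2 * m)) % (2 + x)     ≡⟨ cong (_% (2 + x)) (^-*-assoc x 2 m) ⟨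
  ((x ^ 2) ^ m) % (2 + x)     ≡⟨ %-cong-^ m (x^2%[2+x]≡2^2%[2+x] x) ⟩
  ((2 ^ 2) ^ m) % (2 + x)     ≡⟨ cong (_% (2 + x)) (^-*-assoc 2 2 m) ⟩
  (2 ^ (2 * m)) % (2 + x)     ∎
  where open ≡-Reasoning

2+x∣x^[2m]+1⇔2+x∣2^[2m]+1 : ∀ x m → (2 + x ∣ x ^ (2 * m) + 1) ⇔ (2 + x ∣ 2 ^ (2 * m) + 1)
2+x∣x^[2m]+1⇔2+x∣2^[2m]+1 x m = mk⇔ (∣-resp-% congruent) (∣-resp-% (sym congruent))
  where
  congruent : (x ^ (2 * m) + 1) % (2 + x) ≡ (2 ^ (2 * m) + 1) % (2 + x)
  congruent = %-cong-+ {a = x ^ (2 * m)} {2 ^ (2 * m)} (x^[2m]%[2+x]≡2^[2m]%[2+x] x m) refl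

module FermatSystem (K : ℕ) where

  pattern vA      = Fin.zero
  pattern vD      = Fin.suc Fin.zero
  pattern vQ      = Fin.suc (Fin.suc Fin.zero)
  pattern vT      = Fin.suc (Fin.suc (Fin.suc Fin.zero))
  pattern chain j = Fin.suc (Fin.suc (Fin.suc (Fin.suc j)))
  pattern vX      = chain Fin.zero

  squaring : Fin K → Eqn (5 + K)
  squaring j = mulE (chain (inject₁ j)) (chain (inject₁ j)) (chain (Fin.suc j))

  system : System (5 + K)
  system = succE vX vA ∷ succE vA vD ∷ mulE vD vQ vT ∷ succE (chain (fromℕ K)) vT
         ∷ map squaring (allFin K)

  top : ℕ → ℕ
  top x = x ^ 2 ^ K + 1

  fermat : ℕ
  fermat = top 2

  candidate : ℕ → Fin (5 + K) → ℕ
  candidate x vA        = 1 + x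
  candidate x vD        = 2 + x
  candidate x vQ        = top x / (2 + x)
  candidate x vT        = top x
  candidate x (chain j) = x ^ 2 ^ toℕ j

  candidate-solution : ∀ {x} → 1 ≤ x → 2 + x ∣ top x → Solution system (candidate x)
  candidate-solution {x} 1≤x d∣t = positive , satisfies
    where
    d*q≡t : (2 + x) * (top x / (2 + x)) ≡ top x
    d*q≡t = m*[n/m]≡n d∣t

    positive : ∀ i → 1 ≤ candidate x i
    positive vA        = z<s
    positive vD        = z<s
    positive vQ        = n≢0⇒n>0 λ q≡0 →
      m+1≢0 _ (trans (sym d*q≡t) (trans (cong ((2 + x) *_) q≡0) (*-zeroʳ (2 + x))))
    positive vT        = m≤n+m 1 (x ^ 2 ^ K)
    positive (chain j) = m^n>0 x ⦃ >-nonZero 1≤x ⦄ (2 ^ toℕ j)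

    satisfies : ∀ e → e ∈ system → Sat (candidate x) e
    satisfies _ (here refl)                         = trans (cong (_+ 1) (^-identityʳ x)) (+-comm x 1)
    satisfies _ (there (here refl))                 = +-comm (1 + x) 1
    satisfies _ (there (there (here refl)))         = d*q≡t
    satisfies _ (there (there (there (here refl)))) = cong (λ j → x ^ 2 ^ j + 1) (toℕ-fromℕ K)
    satisfies e (there (there (there (there e∈)))) with ∈-map⁻ squaring e∈
    ... | j , _ , refl = begin
      x ^ 2 ^ toℕ (inject₁ j) * x ^ 2 ^ toℕ (inject₁ j) ≡⟨ cong (λ i → x ^ 2 ^ i * x ^ 2 ^ i) (toℕ-inject₁ j) ⟩
      x ^ 2 ^ toℕ j * x ^ 2 ^ toℕ j                     ≡⟨ ^-2^-suc x (toℕ j) ⟨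
      x ^ 2 ^ suc (toℕ j)                               ∎
      where open ≡-Reasoning

  module _ {y : Fin (5 + K) → ℕ} (sol : Solution system y) where

    private
      x = y vX
      sat = proj₂ sol

    solution-chain : ∀ j → y (chain j) ≡ x ^ 2 ^ toℕ j
    solution-chain = <-weakInduction (λ j → y (chain j) ≡ x ^ 2 ^ toℕ j) (sym (^-identityʳ x)) step
      where
      step : ∀ j → y (chain (inject₁ j)) ≡ x ^ 2 ^ toℕ (inject₁ j) → y (chain (Fin.suc j)) ≡ x ^ 2 ^ suc (toℕ j)
      step j ih = begin
        y (chain (Fin.suc j))                         ≡⟨ sat _ (there (there (there (there (∈-map⁺ squaring (∈-allFin j)))))) ⟨
        y (chain (inject₁ j)) * y (chain (inject₁ j)) ≡⟨ cong (λ v → v * v) (trans ih (cong (λ i → x ^ 2 ^ i) (toℕ-inject₁ j))) ⟩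
        x ^ 2 ^ toℕ j * x ^ 2 ^ toℕ j                 ≡⟨ ^-2^-suc x (toℕ j) ⟨
        x ^ 2 ^ suc (toℕ j)                           ∎
        where open ≡-Reasoning

    solution-a : y vA ≡ 1 + x
    solution-a = trans (sym (sat _ (here refl))) (+-comm x 1)

    solution-d : y vD ≡ 2 + x
    solution-d = trans (sym (sat _ (there (here refl)))) (trans (+-comm (y vA) 1) (cong suc solution-a))

    solution-t : y vT ≡ top x
    solution-t = trans (sym (sat _ (there (there (there (here refl))))))
                       (cong (_+ 1) (trans (solution-chain (fromℕ K)) (cong (λ j → x ^ 2 ^ j) (toℕ-fromℕ K))))

    q*d≡t : y vQ * (2 + x) ≡ top x
    q*d≡t = begin
      y vQ * (2 + x)   ≡⟨ *-comm (y vQ) (2 + x) ⟩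
      (2 + x) * y vQ   ≡⟨ cong (_* y vQ) solution-d ⟨
      y vD * y vQ      ≡⟨ sat _ (there (there (here refl))) ⟩
      y vT             ≡⟨ solution-t ⟩
      top x            ∎
      where open ≡-Reasoning

    solution-divides : 2 + x ∣ top x
    solution-divides = divides (y vQ) (sym q*d≡t)

    solution≡candidate : ∀ i → candidate x i ≡ y i
    solution≡candidate vA        = sym solution-a
    solution≡candidate vD        = sym solution-d
    solution≡candidate vQ        = trans (cong (_/ (2 + x)) (sym q*d≡t)) (m*n/n≡m (y vQ) (2 + x))
    solution≡candidate vT        = sym solution-t
    solution≡candidate (chain j) = sym (solution-chain j)

  finitelyMany : ∀ B → (∀ y → Solution system y → y vX < B) → FinitelyManySolutions system
  finitelyMany B bounded = map candidate (upTo B) , λ y sol →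
    map⁺ (Any.map (λ { refl → solution≡candidate sol }) (∈-upTo⁺ (bounded y sol)))

module _ (k : ℕ) where
  open FermatSystem (suc k)

  2+x∣top⇔2+x∣fermat : ∀ x → (2 + x ∣ top x) ⇔ (2 + x ∣ fermat)
  2+x∣top⇔2+x∣fermat x = 2+x∣x^[2m]+1⇔2+x∣2^[2m]+1 x (2 ^ k)

  solution-divides-fermat : ∀ {y} → Solution system y → 2 + y vX ∣ fermat
  solution-divides-fermat {y} sol = Equivalence.to (2+x∣top⇔2+x∣fermat (y vX)) (solution-divides sol)

  fermatBase : ℕ
  fermatBase = 2 ^ 2 ^ suc k ∸ 1

  2+fermatBase≡fermat : 2 + fermatBase ≡ fermat
  2+fermatBase≡fermat = 2+[m∸1]≡m+1 (m^n>0 2 (2 ^ suc k))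

  system-solvable : Solvable system
  system-solvable = candidate fermatBase , candidate-solution 1≤fermatBase
    (Equivalence.from (2+x∣top⇔2+x∣fermat fermatBase) (subst (_∣ fermat) (sym 2+fermatBase≡fermat) ∣-refl))
    where
    1≤fermatBase : 1 ≤ fermatBase
    1≤fermatBase = ∸-monoˡ-≤ 1 (2≤2^2^n (suc k))

  system-finitelyMany : FinitelyManySolutions system
  system-finitelyMany = finitelyMany fermat λ y sol →
    <⇒≤ (∣⇒≤ ⦃ ≢-nonZero (m+1≢0 _) ⦄ (solution-divides-fermat {y} sol))

  small-solution⇒fermat-composite : ∀ {y} → Solution system y → y vT < top fermatBase → Composite fermat
  small-solution⇒fermat-composite {y} sol t<bound = composite d<fermat (solution-divides-fermat sol)
    where
    x<fermatBase : y vX < fermatBase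
    x<fermatBase = ^-cancelˡ-< (2 ^ suc k) (+-cancelʳ-< 1 _ _ (subst (_< top fermatBase) (solution-t sol) t<bound))
    d<fermat : 2 + y vX < fermat
    d<fermat = subst (2 + y vX <_) 2+fermatBase≡fermat (+-monoʳ-< 2 x<fermatBase)

  small-θ⇒fermat-composite : ∀ b → GoodBound (5 + suc k) b → b < top fermatBase → Composite fermat
  small-θ⇒fermat-composite b bounded b<bound with bounded system system-solvable system-finitelyMany
  ... | y , sol , y≤b = small-solution⇒fermat-composite sol (≤-<-trans (y≤b vT) b<bound)

corollary3 : ∀ (n : ℕ) → 9 < n → ∀ (b : ℕ) → IsTheta n b →
    b < (2 ^ (2 ^ (n ∸ 5)) ∸ 1) ^ (2 ^ (n ∸ 5)) + 1 →
    Composite (2 ^ (2 ^ (n ∸ 5)) + 1)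
corollary3 _ (s≤s (s≤s (s≤s (s≤s (s≤s (s≤s {n = k} _)))))) b (_ , bounded , _) =
  small-θ⇒fermat-composite k b bounded
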